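{- For every face $F$ of $\mathcal{P}_\lambda$, the graph $\phi(F)$ is a face of $\Gamma_{\mathbf{k}}$.
   Context: Fix $n>1$, a sequence $\mathbf{k}=(k_1,\dots,k_s)$ of positive integers with $\sum k_i=n$, $n_i=k_1+\dots+k_i$, $n_0=0$, and real $\lambda=(\lambda_1,\dots,\lambda_n)$ with $\lambda_1=\cdots=\lambda_{n_1}>\lambda_{n_1+1}=\cdots=\lambda_{n_2}>\cdots>\lambda_{n_{s-1}+1}=\cdots=\lambda_n$. Let $I=\{(i,j)\in\mathbb{Z}^2:i,j\ge1,\ i+j\le n\}$. $\mathcal{P}_\lambda\subset\mathbb{R}^I$ is the set of $x=(x_{i,j})$ with $x_{i,j+1}\ge x_{i,j}\ge x_{i+1,j}$ for all $(i,j)\in I$, where $x_{i,n+1-i}:=\lambda_i$. Faces of $\mathcal{P}_\lambda$ are its nonempty faces. $Q^+$ is the directed graph on $\mathbb{Z}_{\ge0}^2$ with edges $((i,j),(i,j+1))$, $((i,j),(i+1,j))$. The terminal vertices are $T_{\mathbf{k}}=\{(n_i,n-n_i):0\le i\le s\}$, $\Gamma_{\mathbf{k}}$ is the induced subgraph of $Q^+$ on $\{(a,b):a\le c,\ b\le d\text{ for some }(c,d)\in T_{\mathbf{k}}\}$, a positive path is a shortest directed path in $\Gamma_{\mathbf{k}}$ from the origin $(0,0)$ to a terminal vertex, and a face of $\Gamma_{\mathbf{k}}$ is a subgraph of $\Gamma_{\mathbf{k}}$ whose vertex set contains all terminal vertices and which is a union of positive paths. For a face $F$ of $\mathcal{P}_\lambda$,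 $\phi(F)$ is the subgraph of $Q^+$ whose edge set consists of: $((0,i),(0,i+1))$ and $((i,0),(i+1,0))$ for $0\le i\le n-1$; $((i-1,j),(i,j))$ for each $(i,j)\in I$ such that some point of $F$ has $x_{i,j}<x_{i,j+1}$; $((i,j-1),(i,j))$ for each $(i,j)\in I$ such that some point of $F$ has $x_{i,j}>x_{i+1,j}$; and whose vertex set is the set of endpoints of these edges. -}

module Defs where

open import Level using (Level; _⊔_) renaming (suc to lsuc; zero to lzero)
open import Algebra.Bundles using (CommutativeRing)
open import Relation.Binary.Structures using (IsTotalOrder)
open import Relation.Binary.PropositionalEquality using (_≡_)
open import Relation.Nullary using (¬_; yes; no)
open import Data.Nat as ℕ using (ℕ; zero; suc; _∸_)
open import Data.Product using (_×_; _,_; ∃; Σ; proj₁; proj₂)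
open import Data.Sum using (_⊎_)
open import Data.List using (List; []; _∷_; map)
open import Data.List.Scans.Base using (scanl)
open import Data.List.Relation.Unary.All using (All)
open import Data.List.Membership.Propositional using (_∈_)
open import Function.Bundles using (_⇔_)

record OrderedField (c ℓ₁ ℓ₂ : Level) : Set (lsuc (c ⊔ ℓ₁ ⊔ ℓ₂)) where
  field
    commutativeRing : CommutativeRing c ℓ₁
  open CommutativeRing commutativeRing public
  field
    _≤_          : Carrier → Carrier → Set ℓ₂
    isTotalOrder : IsTotalOrder _≈_ _≤_
    +-monoˡ-≤    : ∀ {x y} z → x ≤ y → (x + z) ≤ (y + z)
    0≤*          : ∀ {x y} → 0# ≤ x → 0# ≤ y → 0# ≤ (x * y)
    0≉1          : ¬ (0# ≈ 1#)
    inverse      : ∀ x → ¬ (x ≈ 0#) → ∃ λ y → (x * y) ≈ 1#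

  _<_ : Carrier → Carrier → Set (ℓ₁ ⊔ ℓ₂)
  x < y = (x ≤ y) × ¬ (x ≈ y)

Vertex : Set
Vertex = ℕ × ℕ

data Dir : Set where
  right down : Dir

Edge : Set
Edge = Vertex × Dir

tail : Edge → Vertex
tail (v , _) = v

step : Vertex → Dir → Vertex
step (i , j) right = (i , suc j)
step (i , j) down  = (suc i , j)

head : Edge → Vertex
head (v , d) = step v d

origin : Vertex
origin = (0 , 0)

pathVerts : Vertex → List Dir → List Vertex
pathVerts v []       = v ∷ []
pathVerts v (d ∷ ds) = v ∷ pathVerts (step v d) ds

pathEdges : Vertex → List Dir → List Edge
pathEdges v []       = []
pathEdges v (d ∷ ds) = (v , d) ∷ pathEdges (step v d) ds

pathEnd : Vertex → List Dir → Vertex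
pathEnd v []       = v
pathEnd v (d ∷ ds) = pathEnd (step v d) ds

module GammaGraph (n : ℕ) (k : List ℕ) where

  partialSums : List ℕ
  partialSums = scanl ℕ._+_ 0 k

  Terminal : Vertex → Set
  Terminal v = v ∈ map (λ m → (m , n ∸ m)) partialSums

  ΓV : Vertex → Set
  ΓV (a , b) = ∃ λ t → Terminal t × (a ℕ.≤ proj₁ t) × (b ℕ.≤ proj₂ t)

  ΓE : Edge → Set
  ΓE e = ΓV (tail e) × ΓV (head e)

  -- positive path: directed path in Γ_k from the origin to a terminal
  -- vertex (every directed path in Q⁺ from (0,0) to (a,b) has length
  -- a+b, hence is automatically a shortest one)
  PositivePath : List Dir → Set
  PositivePath ds = All ΓV (pathVerts origin ds) × Terminal (pathEnd origin ds)

  IsΓFace : ∀ {ℓ} → (Vertex → Set ℓ) → (Edge → Set ℓ) → Set ℓ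
  IsΓFace V E =
      (∀ v → V v → ΓV v)
    × (∀ e → E e → ΓE e)
    × (∀ t → Terminal t → V t)
    × (∀ v → V v → ∃ λ ds → PositivePath ds × v ∈ pathVerts origin ds
                           × All V (pathVerts origin ds) × All E (pathEdges origin ds))
    × (∀ e → E e → ∃ λ ds → PositivePath ds × e ∈ pathEdges origin ds
                           × All V (pathVerts origin ds) × All E (pathEdges origin ds))

module GT {c ℓ₁ ℓ₂} (K : OrderedField c ℓ₁ ℓ₂) (n : ℕ) (lam : ℕ → OrderedField.Carrier K) where
  open OrderedField K

  InI : ℕ → ℕ → Set
  InI i j = (1 ℕ.≤ i) × (1 ℕ.≤ j) × (i ℕ.+ j ℕ.≤ n)

  -- a point of ℝ^I, represented as a function ℕ → ℕ → K
  -- (only the coordinates in I are ever used)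
  Point : Set c
  Point = ℕ → ℕ → Carrier

  xe : Point → ℕ → ℕ → Carrier
  xe x i j with (i ℕ.+ j) ℕ.≟ suc n
  ... | yes _ = lam i
  ... | no  _ = x i j

  InP : Point → Set (ℓ₂)
  InP x = ∀ i j → InI i j → (x i j ≤ xe x i (suc j)) × (xe x (suc i) j ≤ x i j)

  sumTo : ℕ → (ℕ → Carrier) → Carrier
  sumTo zero    f = 0#
  sumTo (suc m) f = sumTo m f + f (suc m)

  dot : Point → Point → Carrier
  dot w x = sumTo n (λ i → sumTo (n ∸ i) (λ j → w i j * x i j))

  -- a (nonempty) face of P_λ: the set of maximisers in P_λ of a linear
  -- functional w that attains its maximum on P_λ at x₀
  record Face : Set (c ⊔ ℓ₂) where
    field
      w      : Point
      x₀     : Point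
      x₀∈P   : InP x₀
      maxim  : ∀ x → InP x → dot w x ≤ dot w x₀

  _∈F_ : Point → Face → Set (ℓ₁ ⊔ ℓ₂)
  x ∈F F = InP x × (dot (Face.w F) x ≈ dot (Face.w F) (Face.x₀ F))

  φE : Face → Edge → Set (c ⊔ ℓ₁ ⊔ ℓ₂)
  φE F ((i , j) , right) =
      ((i ≡ 0) × (j ℕ.< n))
    ⊎ (InI i (suc j) × ∃ λ x → (x ∈F F) × (xe x (suc i) (suc j) < x i (suc j)))
  φE F ((i , j) , down) =
      ((j ≡ 0) × (i ℕ.< n))
    ⊎ (InI (suc i) j × ∃ λ x → (x ∈F F) × (x (suc i) j < xe x (suc i) (suc j)))

  φV : Face → Vertex → Set (c ⊔ ℓ₁ ⊔ ℓ₂)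
  φV F v = ∃ λ e → φE F e × ((tail e ≡ v) ⊎ (head e ≡ v))

-- hypothesis on λ: constant on the blocks of k, strictly decreasing
-- between consecutive blocks (indices 1 … n)
module _ {c ℓ₁ ℓ₂} (K : OrderedField c ℓ₁ ℓ₂) where
  open OrderedField K

  Adapted : (n : ℕ) → List ℕ → (ℕ → Carrier) → Set (ℓ₁ ⊔ ℓ₂)
  Adapted n k lam = ∀ i → 1 ℕ.≤ i → i ℕ.< n →
      (i ∈ GammaGraph.partialSums n k → lam (suc i) < lam i)
    × (¬ (i ∈ GammaGraph.partialSums n k) → lam i ≈ lam (suc i))

-- φ(F) is the union of the graphs φ(x) of the points x ∈ F, and a nonempty
-- union of faces of Γ_k is again a face, so it suffices to treat one point x.
-- Around a vertex (i , j) with i , j ≥ 1 the four entries a = x_{i+1,j},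
-- b = x_{i,j}, c = x_{i,j+1}, d = x_{i+1,j+1} satisfy a ≤ b ≤ c and
-- a ≤ d ≤ c; the edges entering (i , j) record a < b and b < c, those
-- leaving it d < c and a < d. Hence (i , j) has an incoming edge iff it has
-- an outgoing one iff a < c, so every vertex of φ(x) lies on a monotone path
-- from the origin to the antidiagonal i + j = n. On the antidiagonal
-- a = λ_{i+1} and c = λ_i, and a < c holds exactly at the terminal vertices.
module Submission where

open import Defs
open import Level using (Level; _⊔_)
open import Relation.Binary.PropositionalEquality
  using (_≡_; refl; sym; trans; cong; cong₂; subst)
open import Data.Nat using (ℕ; zero; suc; _+_; _∸_; _<_; _≤_; z≤n; s≤s)
import Data.Nat as ℕ
import Data.Nat.Properties as ℕ
open import Data.List using (List; []; _∷_; _++_)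
open import Data.Nat.ListAction using (sum)
open import Data.List.Scans.Base using (scanl)
open import Data.List.Relation.Unary.All as All using (All; []; _∷_)
open import Data.List.Relation.Unary.Any using (here; there)
open import Data.List.Membership.Propositional using (_∈_)
open import Data.List.Membership.Propositional.Properties using (∈-map⁺; ∈-map⁻)
open import Data.List.Membership.DecPropositional ℕ._≟_ using (_∈?_)
open import Data.Product using (_×_; _,_; ∃; ∃₂; Σ; proj₁; proj₂)
open import Data.Sum using (_⊎_; inj₁; inj₂)
open import Data.Empty using (⊥-elim)
open import Function using (id)
open import Relation.Nullary using (yes; no)
open import Relation.Binary.Structures using (IsTotalOrder)
import Relation.Binary.Construct.NonStrictToStrict as NonStrictToStrict

module OrderedFieldProperties {c ℓ₁ ℓ₂} (K : OrderedField c ℓ₁ ℓ₂) where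
  open OrderedField K renaming (_+_ to _+ᴷ_; _≤_ to _≤ᴷ_; _<_ to _<ᴷ_; sym to ≈-sym; trans to ≈-trans)
  open IsTotalOrder isTotalOrder using (antisym; total; ≲-respˡ-≈; ≲-respʳ-≈)
    renaming (trans to ≤-trans)
  private module Strict = NonStrictToStrict _≈_ _≤ᴷ_

  <-≤-trans : ∀ {x y z} → x <ᴷ y → y ≤ᴷ z → x <ᴷ z
  <-≤-trans = Strict.<-≤-trans ≈-sym ≤-trans antisym ≲-respʳ-≈

  ≤-<-trans : ∀ {x y z} → x ≤ᴷ y → y <ᴷ z → x <ᴷ z
  ≤-<-trans = Strict.≤-<-trans ≤-trans antisym ≲-respˡ-≈

  +-cancelʳ-≤ : ∀ {x y} z → (x +ᴷ z) ≤ᴷ (y +ᴷ z) → x ≤ᴷ y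
  +-cancelʳ-≤ {x} {y} z x+z≤y+z =
    ≲-respˡ-≈ (+-z-cancel x) (≲-respʳ-≈ (+-z-cancel y) (+-monoˡ-≤ (- z) x+z≤y+z))
    where
    +-z-cancel : ∀ u → ((u +ᴷ z) +ᴷ - z) ≈ u
    +-z-cancel u = ≈-trans (+-assoc u z (- z)) (≈-trans (+-congˡ (-‿inverseʳ z)) (+-identityʳ u))

  -- Comparing b + b with a + d tells on which side of b the gap lies.
  <-cotrans : ∀ {a b d} → a ≤ᴷ b → b ≤ᴷ d → a <ᴷ d → a <ᴷ b ⊎ b <ᴷ d
  <-cotrans {a} {b} {d} a≤b b≤d (a≤d , a≉d) with total (b +ᴷ b) (a +ᴷ d)
  ... | inj₁ 2b≤a+d = inj₂ (b≤d , λ b≈d → a≉d (antisym a≤d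
          (+-cancelʳ-≤ d (≲-respˡ-≈ (+-cong b≈d b≈d) 2b≤a+d))))
  ... | inj₂ a+d≤2b = inj₁ (a≤b , λ a≈b → a≉d (antisym a≤d
          (+-cancelʳ-≤ a (≲-respˡ-≈ (+-comm a d) (≲-respʳ-≈ (+-cong (≈-sym a≈b) (≈-sym a≈b)) a+d≤2b)))))

scanl-+-≤ : ∀ a ks {m} → m ∈ scanl _+_ a ks → m ≤ a + sum ks
scanl-+-≤ a []       (here refl) = ℕ.m≤m+n a 0
scanl-+-≤ a (x ∷ xs) (here refl) = ℕ.m≤m+n a _
scanl-+-≤ a (x ∷ xs) {m} (there m∈) =
  subst (m ≤_) (ℕ.+-assoc a x (sum xs)) (scanl-+-≤ (a + x) xs m∈)

+-sum∈scanl-+ : ∀ a ks → a + sum ks ∈ scanl _+_ a ks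
+-sum∈scanl-+ a []       = here (ℕ.+-identityʳ a)
+-sum∈scanl-+ a (x ∷ xs) =
  there (subst (_∈ scanl _+_ (a + x) xs) (ℕ.+-assoc a x (sum xs)) (+-sum∈scanl-+ (a + x) xs))

height : Vertex → ℕ
height (i , j) = i + j

height-step : ∀ v d → height (step v d) ≡ suc (height v)
height-step (i , j) right = ℕ.+-suc i j
height-step (i , j) down  = refl

pathEnd-≥ : ∀ i j ds → i ≤ proj₁ (pathEnd (i , j) ds) × j ≤ proj₂ (pathEnd (i , j) ds)
pathEnd-≥ i j []           = ℕ.≤-refl , ℕ.≤-refl
pathEnd-≥ i j (right ∷ ds) with pathEnd-≥ i (suc j) ds
... | i≤ , 1+j≤ = i≤ , ℕ.≤-trans (ℕ.n≤1+n j) 1+j≤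
pathEnd-≥ i j (down ∷ ds)  with pathEnd-≥ (suc i) j ds
... | 1+i≤ , j≤ = ℕ.≤-trans (ℕ.n≤1+n i) 1+i≤ , j≤

pathEnd∈pathVerts-++ : ∀ u ds es → pathEnd u ds ∈ pathVerts u (ds ++ es)
pathEnd∈pathVerts-++ u []       []       = here refl
pathEnd∈pathVerts-++ u []       (_ ∷ _)  = here refl
pathEnd∈pathVerts-++ u (d ∷ ds) es       = there (pathEnd∈pathVerts-++ (step u d) ds es)

pathEnd∈pathEdges-++ : ∀ u ds d es → (pathEnd u ds , d) ∈ pathEdges u (ds ++ d ∷ es)
pathEnd∈pathEdges-++ u []        d es = here refl
pathEnd∈pathEdges-++ u (d′ ∷ ds) d es = there (pathEnd∈pathEdges-++ (step u d′) ds d es)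

module Walks {ℓ} (V : Vertex → Set ℓ) (E : Edge → Set ℓ) where

  record Walk (u : Vertex) (ds : List Dir) (w : Vertex) : Set ℓ where
    constructor walk
    field
      ends  : pathEnd u ds ≡ w
      verts : All V (pathVerts u ds)
      edges : All E (pathEdges u ds)

  Walk-++ : ∀ {u v w} ds {es} → Walk u ds v → Walk v es w → Walk u (ds ++ es) w
  Walk-++ []       (walk refl _ _) q = q
  Walk-++ (d ∷ ds) (walk u↝v (vu ∷ vs) (e ∷ es)) q with Walk-++ ds (walk u↝v vs es) q
  ... | walk u↝w vs′ es′ = walk u↝w (vu ∷ vs′) (e ∷ es′)

  Walk-end : ∀ {u w} ds → Walk u ds w → V w
  Walk-end []       (walk refl (vu ∷ []) []) = vu
  Walk-end (d ∷ ds) (walk u↝w (_ ∷ vs) (_ ∷ es)) = Walk-end ds (walk u↝w vs es)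

  Incoming : Vertex → Set ℓ
  Incoming v = ∃₂ λ u d → step u d ≡ v × E (u , d)

  module _ (tail∈V : ∀ {e} → E e → V (tail e)) where

    walkFromOrigin : (∀ {v} → V v → 0 < height v → Incoming v) →
                     ∀ {v} → V v → ∃ λ ds → Walk origin ds v
    walkFromOrigin incoming {v} v∈V = go (height v) refl v∈V
      where
      go : ∀ h {v} → height v ≡ h → V v → ∃ λ ds → Walk origin ds v
      go zero {zero , zero} _ v∈V = [] , walk refl (v∈V ∷ []) []
      go (suc h) {v} hv v∈V with incoming v∈V (subst (0 <_) (sym hv) (s≤s z≤n))
      ... | u , d , refl , e with go h (ℕ.suc-injective (trans (sym (height-step u d)) hv)) (tail∈V e)
      ... | ds , o↝u = ds ++ d ∷ [] , Walk-++ ds o↝u (walk refl (tail∈V e ∷ v∈V ∷ []) (e ∷ []))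

  module _ (head∈V : ∀ {e} → E e → V (head e)) (N : ℕ) where

    walkToHeight : (∀ {v} → V v → height v < N → ∃ λ d → E (v , d)) →
                   ∀ {v} → V v → height v ≤ N → ∃₂ λ ds w → Walk v ds w × height w ≡ N
    walkToHeight outgoing {v} v∈V hv≤N = go (N ∸ height v) (ℕ.m∸n+n≡m hv≤N) v∈V
      where
      go : ∀ f {v} → f + height v ≡ N → V v → ∃₂ λ ds w → Walk v ds w × height w ≡ N
      go zero    {v} hv v∈V = [] , v , walk refl (v∈V ∷ []) [] , hv
      go (suc f) {v} hv v∈V with outgoing v∈V (subst (height v <_) hv (s≤s (ℕ.m≤n+m (height v) f)))
      ... | d , e with go f (trans (cong (f +_) (height-step v d)) (trans (ℕ.+-suc f _) hv)) (head∈V e)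
      ... | ds , w , walk ends vs es , hw = d ∷ ds , w , walk ends (v∈V ∷ vs) (e ∷ es) , hw

module _ (n : ℕ) (k : List ℕ) where
  open GammaGraph n k

  record LocalΓFace {ℓ} (V : Vertex → Set ℓ) (E : Edge → Set ℓ) : Set ℓ where
    field
      tail∈V       : ∀ {e} → E e → V (tail e)
      head∈V       : ∀ {e} → E e → V (head e)
      height≤n     : ∀ {v} → V v → height v ≤ n
      incoming     : ∀ {v} → V v → 0 < height v → Walks.Incoming V E v
      outgoing     : ∀ {v} → V v → height v < n → ∃ λ d → E (v , d)
      terminal∈V   : ∀ {t} → Terminal t → V t
      top⇒terminal : ∀ {v} → V v → height v ≡ n → Terminal v

  LocalΓFace⇒IsΓFace : ∀ {ℓ} {V : Vertex → Set ℓ} {E : Edge → Set ℓ} → LocalΓFace V E → IsΓFace V E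
  LocalΓFace⇒IsΓFace {V = V} {E} L =
    (λ v → V⊆ΓV) , (λ e → E⊆ΓE) , (λ t → terminal∈V) , vertexPath , edgePath
    where
    open LocalΓFace L
    open Walks V E

    toTop : ∀ {v} → V v → ∃₂ λ ds w → Walk v ds w × height w ≡ n
    toTop v∈V = walkToHeight head∈V n outgoing v∈V (height≤n v∈V)

    fromOrigin : ∀ {v} → V v → ∃ λ ds → Walk origin ds v
    fromOrigin = walkFromOrigin tail∈V incoming

    V⊆ΓV : ∀ {v} → V v → ΓV v
    V⊆ΓV {i , j} v∈V with toTop v∈V
    ... | ds , w , v↝w@(walk refl _ _) , hw =
      w , top⇒terminal (Walk-end ds v↝w) hw , pathEnd-≥ i j ds

    E⊆ΓE : ∀ {e} → E e → ΓE e
    E⊆ΓE e∈E = V⊆ΓV (tail∈V e∈E) , V⊆ΓV (head∈V e∈E)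

    positive : ∀ {ds w} → Walk origin ds w → height w ≡ n → PositivePath ds
    positive {ds} o↝w hw =
      All.map V⊆ΓV (Walk.verts o↝w) ,
      subst Terminal (sym (Walk.ends o↝w)) (top⇒terminal (Walk-end ds o↝w) hw)

    vertexPath : ∀ v → V v → ∃ λ ds → PositivePath ds × v ∈ pathVerts origin ds
                   × All V (pathVerts origin ds) × All E (pathEdges origin ds)
    vertexPath v v∈V with fromOrigin v∈V | toTop v∈V
    ... | ds , o↝v | es , w , v↝w , hw =
      ds ++ es , positive o↝w hw ,
      subst (_∈ pathVerts origin (ds ++ es)) (Walk.ends o↝v) (pathEnd∈pathVerts-++ origin ds es) ,
      Walk.verts o↝w , Walk.edges o↝w
      where
      o↝w : Walk origin (ds ++ es) w
      o↝w = Walk-++ ds o↝v v↝w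

    edgePath : ∀ e → E e → ∃ λ ds → PositivePath ds × e ∈ pathEdges origin ds
                 × All V (pathVerts origin ds) × All E (pathEdges origin ds)
    edgePath (v , d) e∈E with fromOrigin (tail∈V e∈E) | toTop (head∈V e∈E)
    ... | ds , o↝v | es , w , walk ends vs es∈E , hw =
      ds ++ d ∷ es , positive o↝w hw ,
      subst (λ u → (u , d) ∈ pathEdges origin (ds ++ d ∷ es)) (Walk.ends o↝v)
        (pathEnd∈pathEdges-++ origin ds d es) ,
      Walk.verts o↝w , Walk.edges o↝w
      where
      o↝w : Walk origin (ds ++ d ∷ es) w
      o↝w = Walk-++ ds o↝v (walk ends (tail∈V e∈E ∷ vs) (e∈E ∷ es∈E))

  ⋃-IsΓFace : ∀ {a ℓ ℓ′} {A : Set a} {V : Vertex → Set ℓ} {E : Edge → Set ℓ}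
    (Vα : A → Vertex → Set ℓ′) (Eα : A → Edge → Set ℓ′) →
    A → (∀ α → IsΓFace (Vα α) (Eα α)) →
    (∀ {α v} → Vα α v → V v) → (∀ {α e} → Eα α e → E e) →
    (∀ {v} → V v → ∃ λ α → Vα α v) → (∀ {e} → E e → ∃ λ α → Eα α e) →
    IsΓFace V E
  ⋃-IsΓFace {V = V} {E} Vα Eα α₀ face Vα⊆V Eα⊆E V⊆⋃ E⊆⋃ =
    V⊆ΓV , E⊆ΓE , terminal∈V , vertexPath , edgePath
    where
    V⊆ΓV : ∀ v → V v → ΓV v
    V⊆ΓV v v∈V with V⊆⋃ v∈V
    ... | α , v∈Vα with face α
    ... | Vα⊆ΓV , _ = Vα⊆ΓV v v∈Vα

    E⊆ΓE : ∀ e → E e → ΓE e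
    E⊆ΓE e e∈E with E⊆⋃ e∈E
    ... | α , e∈Eα with face α
    ... | _ , Eα⊆ΓE , _ = Eα⊆ΓE e e∈Eα

    terminal∈V : ∀ t → Terminal t → V t
    terminal∈V t t∈T with face α₀
    ... | _ , _ , terminal∈Vα₀ , _ = Vα⊆V (terminal∈Vα₀ t t∈T)

    vertexPath : ∀ v → V v → ∃ λ ds → PositivePath ds × v ∈ pathVerts origin ds
                   × All V (pathVerts origin ds) × All E (pathEdges origin ds)
    vertexPath v v∈V with V⊆⋃ v∈V
    ... | α , v∈Vα with face α
    ... | _ , _ , _ , vertexPathα , _ with vertexPathα v v∈Vα
    ... | ds , pos , v∈ds , vs , es = ds , pos , v∈ds , All.map Vα⊆V vs , All.map Eα⊆E es

    edgePath : ∀ e → E e → ∃ λ ds → PositivePath ds × e ∈ pathEdges origin ds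
                 × All V (pathVerts origin ds) × All E (pathEdges origin ds)
    edgePath e e∈E with E⊆⋃ e∈E
    ... | α , e∈Eα with face α
    ... | _ , _ , _ , _ , edgePathα with edgePathα e e∈Eα
    ... | ds , pos , e∈ds , vs , es = ds , pos , e∈ds , All.map Vα⊆V vs , All.map Eα⊆E es

module PointGraph {c ℓ₁ ℓ₂} (K : OrderedField c ℓ₁ ℓ₂) (n : ℕ) (lam : ℕ → OrderedField.Carrier K) where
  open OrderedField K using () renaming (_≤_ to _≤ᴷ_; _<_ to _<ᴷ_)
  open OrderedFieldProperties K
  open GT K n lam

  -- φ₁ x is the graph φ assigns to the single point x, with every entry read
  -- through xe; φ F is the union of the φ₁ x over the points x of F.
  φ₁E : Point → Edge → Set (ℓ₁ ⊔ ℓ₂)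
  φ₁E x ((i , j) , right) =
    (i ≡ 0 × j < n) ⊎ (InI i (suc j) × xe x (suc i) (suc j) <ᴷ xe x i (suc j))
  φ₁E x ((i , j) , down) =
    (j ≡ 0 × i < n) ⊎ (InI (suc i) j × xe x (suc i) j <ᴷ xe x (suc i) (suc j))

  φ₁V : Point → Vertex → Set (ℓ₁ ⊔ ℓ₂)
  φ₁V x v = ∃ λ e → φ₁E x e × (tail e ≡ v ⊎ head e ≡ v)

  xe-inner : ∀ x {i j} → i + j ≤ n → xe x i j ≡ x i j
  xe-inner x {i} {j} i+j≤n with (i + j) ℕ.≟ suc n
  ... | yes i+j≡1+n = ⊥-elim (ℕ.1+n≰n (subst (_≤ n) i+j≡1+n i+j≤n))
  ... | no  _       = refl

  xe-boundary : ∀ x {i j} → i + j ≡ suc n → xe x i j ≡ lam i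
  xe-boundary x {i} {j} i+j≡1+n with (i + j) ℕ.≟ suc n
  ... | yes _       = refl
  ... | no  i+j≢1+n = ⊥-elim (i+j≢1+n i+j≡1+n)

  xe-I : ∀ x {i j} → InI i j → xe x i j ≡ x i j
  xe-I x (_ , _ , i+j≤n) = xe-inner x i+j≤n

  inI : ∀ {i j} → suc i + suc j ≤ n → InI (suc i) (suc j)
  inI i+j≤n = s≤s z≤n , s≤s z≤n , i+j≤n

  shiftʳ : ∀ {i j} → suc (suc i) + suc j ≤ n → suc i + suc (suc j) ≤ n
  shiftʳ {i} {j} = subst (_≤ n) (sym (ℕ.+-suc (suc i) (suc j)))

  shiftˡ : ∀ {i j} → suc i + suc (suc j) ≤ n → suc (suc i) + suc j ≤ n
  shiftˡ {i} {j} = subst (_≤ n) (ℕ.+-suc (suc i) (suc j))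

  Gap : Point → ℕ → ℕ → Set (ℓ₁ ⊔ ℓ₂)
  Gap x i j = xe x (suc i) j <ᴷ xe x i (suc j)

  Gap-antidiagonal : ∀ x {i j} → suc i + suc j ≡ n →
                     Gap x (suc i) (suc j) ≡ (lam (suc (suc i)) <ᴷ lam (suc i))
  Gap-antidiagonal x {i} {j} i+j≡n =
    cong₂ _<ᴷ_ (xe-boundary x (cong suc i+j≡n))
               (xe-boundary x (trans (ℕ.+-suc (suc i) (suc j)) (cong suc i+j≡n)))

  module _ {x : Point} (x∈P : InP x) where
    open Walks (φ₁V x) (φ₁E x) using (Incoming)

    xe-≤-right : ∀ {i j} → InI i j → xe x i j ≤ᴷ xe x i (suc j)
    xe-≤-right {i} {j} ij∈I = subst (_≤ᴷ xe x i (suc j)) (sym (xe-I x ij∈I)) (proj₁ (x∈P i j ij∈I))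

    xe-≤-down : ∀ {i j} → InI i j → xe x (suc i) j ≤ᴷ xe x i j
    xe-≤-down {i} {j} ij∈I = subst (xe x (suc i) j ≤ᴷ_) (sym (xe-I x ij∈I)) (proj₂ (x∈P i j ij∈I))

    φ₁V⇒Gap : ∀ {i j} → φ₁V x (suc i , suc j) → Gap x (suc i) (suc j)
    φ₁V⇒Gap ((_ , right) , inj₁ (() , _) , inj₁ refl)
    φ₁V⇒Gap {i} {j} ((_ , right) , inj₂ ((_ , _ , h) , d<c) , inj₁ refl) =
      ≤-<-trans (xe-≤-right (inI {suc i} {j} (shiftˡ h))) d<c
    φ₁V⇒Gap ((_ , down) , inj₁ (() , _) , inj₁ refl)
    φ₁V⇒Gap {i} {j} ((_ , down) , inj₂ ((_ , _ , h) , a<d) , inj₁ refl) =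
      <-≤-trans a<d (xe-≤-down (inI (shiftʳ {i} {j} h)))
    φ₁V⇒Gap ((_ , right) , inj₁ (() , _) , inj₂ refl)
    φ₁V⇒Gap ((_ , right) , inj₂ (ij∈I , a<b) , inj₂ refl) = <-≤-trans a<b (xe-≤-right ij∈I)
    φ₁V⇒Gap ((_ , down) , inj₁ (() , _) , inj₂ refl)
    φ₁V⇒Gap ((_ , down) , inj₂ (ij∈I , b<c) , inj₂ refl) = ≤-<-trans (xe-≤-down ij∈I) b<c

    Gap⇒incoming : ∀ {i j} → suc i + suc j ≤ n → Gap x (suc i) (suc j) → Incoming (suc i , suc j)
    Gap⇒incoming {i} {j} h a<c with <-cotrans (xe-≤-down (inI h)) (xe-≤-right (inI h)) a<c
    ... | inj₁ a<b = (suc i , j) , right , refl , inj₂ (inI h , a<b)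
    ... | inj₂ b<c = (i , suc j) , down , refl , inj₂ (inI h , b<c)

    Gap⇒outgoing : ∀ {i j} → suc i + suc j < n → Gap x (suc i) (suc j) →
                   ∃ λ d → φ₁E x ((suc i , suc j) , d)
    Gap⇒outgoing {i} {j} h a<c
      with <-cotrans (xe-≤-right (inI {suc i} {j} h)) (xe-≤-down (inI (shiftʳ {i} {j} h))) a<c
    ... | inj₁ a<d = down , inj₂ (inI h , a<d)
    ... | inj₂ d<c = right , inj₂ (inI (shiftʳ {i} {j} h) , d<c)

module _ {c ℓ₁ ℓ₂} {K : OrderedField c ℓ₁ ℓ₂} {n : ℕ} {k : List ℕ} {lam : ℕ → OrderedField.Carrier K}
         (1≤n : 1 ≤ n) (sum-k≡n : sum k ≡ n) (adapted : Adapted K n k lam) where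
  open OrderedField K using () renaming (sym to ≈-sym)
  open GammaGraph n k
  open GT K n lam using (Point; InP)
  open PointGraph K n lam

  partialSum⇒Terminal : ∀ {m} → m ∈ partialSums → Terminal (m , n ∸ m)
  partialSum⇒Terminal = ∈-map⁺ (λ m → (m , n ∸ m))

  partialSum≤n : ∀ {m} → m ∈ partialSums → m ≤ n
  partialSum≤n {m} m∈ = subst (m ≤_) sum-k≡n (scanl-+-≤ 0 k m∈)

  n∈partialSums : n ∈ partialSums
  n∈partialSums = subst (_∈ partialSums) sum-k≡n (+-sum∈scanl-+ 0 k)

  antidiagonal-< : ∀ {i j} → suc i + suc j ≡ n → suc i < n
  antidiagonal-< {i} i+j≡n = subst (suc i <_) i+j≡n (ℕ.m<m+n (suc i) (s≤s z≤n))

  partialSum⇒Gap : ∀ x {i j} → suc i + suc j ≡ n → suc i ∈ partialSums → Gap x (suc i) (suc j)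
  partialSum⇒Gap x i+j≡n i∈ =
    subst id (sym (Gap-antidiagonal x i+j≡n)) (proj₁ (adapted _ (s≤s z≤n) (antidiagonal-< i+j≡n)) i∈)

  Gap⇒partialSum : ∀ x {i j} → suc i + suc j ≡ n → Gap x (suc i) (suc j) → suc i ∈ partialSums
  Gap⇒partialSum x {i} i+j≡n gap with suc i ∈? partialSums
  ... | yes i∈ = i∈
  ... | no  i∉ = ⊥-elim (proj₂ (subst id (Gap-antidiagonal x i+j≡n) gap)
                   (≈-sym (proj₂ (adapted _ (s≤s z≤n) (antidiagonal-< i+j≡n)) i∉)))

  module _ {x : Point} (x∈P : InP x) where
    open Walks (φ₁V x) (φ₁E x) using (Incoming)

    head-height≤n : ∀ {e} → φ₁E x e → height (head e) ≤ n
    head-height≤n {(_ , _) , right} (inj₁ (refl , j<n))     = j<n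
    head-height≤n {(_ , _) , right} (inj₂ ((_ , _ , h) , _)) = h
    head-height≤n {(i , _) , down}  (inj₁ (refl , i<n))     = subst (_≤ n) (sym (ℕ.+-identityʳ (suc i))) i<n
    head-height≤n {(_ , _) , down}  (inj₂ ((_ , _ , h) , _)) = h

    height≤n : ∀ {v} → φ₁V x v → height v ≤ n
    height≤n (e , e∈E , inj₂ refl) = head-height≤n e∈E
    height≤n ((v , d) , e∈E , inj₁ refl) =
      ℕ.<⇒≤ (subst (_≤ n) (height-step v d) (head-height≤n e∈E))

    incoming : ∀ {v} → φ₁V x v → 0 < height v → Incoming v
    incoming {zero , suc j} v∈V _ = (0 , j) , right , refl , inj₁ (refl , height≤n v∈V)
    incoming {suc i , zero} v∈V _ =
      (i , 0) , down , refl , inj₁ (refl , subst (_≤ n) (ℕ.+-identityʳ (suc i)) (height≤n v∈V))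
    incoming {suc i , suc j} v∈V _ = Gap⇒incoming x∈P (height≤n v∈V) (φ₁V⇒Gap x∈P v∈V)

    outgoing : ∀ {v} → φ₁V x v → height v < n → ∃ λ d → φ₁E x (v , d)
    outgoing {zero , j}     _ j<n = right , inj₁ (refl , j<n)
    outgoing {suc i , zero} _ i<n = down , inj₁ (refl , subst (_< n) (ℕ.+-identityʳ (suc i)) i<n)
    outgoing {suc i , suc j} v∈V h = Gap⇒outgoing x∈P h (φ₁V⇒Gap x∈P v∈V)

    partialSum∈φ₁V : ∀ {m} → m ∈ partialSums → φ₁V x (m , n ∸ m)
    partialSum∈φ₁V {zero} _ =
      ((0 , n ∸ 1) , right) , inj₁ (refl , ℕ.≤-reflexive 1+[n∸1]≡n) , inj₂ (cong (0 ,_) 1+[n∸1]≡n)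
      where
      1+[n∸1]≡n : suc (n ∸ 1) ≡ n
      1+[n∸1]≡n = ℕ.m+[n∸m]≡n 1≤n
    partialSum∈φ₁V {suc i} i∈ with n ∸ suc i in n∸i≡
    ... | zero  = ((i , 0) , down) , inj₁ (refl , partialSum≤n i∈) , inj₂ refl
    ... | suc j with Gap⇒incoming x∈P (ℕ.≤-reflexive i+j≡n) (partialSum⇒Gap x i+j≡n i∈)
      where
      i+j≡n : suc i + suc j ≡ n
      i+j≡n = trans (cong (suc i +_) (sym n∸i≡)) (ℕ.m+[n∸m]≡n (partialSum≤n i∈))
    ...   | u , d , u↦v , e∈E = (u , d) , e∈E , inj₂ u↦v

    terminal∈φ₁V : ∀ {t} → Terminal t → φ₁V x t
    terminal∈φ₁V t∈T with ∈-map⁻ (λ m → (m , n ∸ m)) t∈T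
    ... | m , m∈ , refl = partialSum∈φ₁V m∈

    top⇒terminal : ∀ {v} → φ₁V x v → height v ≡ n → Terminal v
    top⇒terminal {zero , _} _ refl = here refl
    top⇒terminal {suc i , zero} _ i+0≡n =
      subst Terminal (cong₂ _,_ (trans (sym i+0≡n) (ℕ.+-identityʳ (suc i))) (ℕ.n∸n≡0 n))
        (partialSum⇒Terminal n∈partialSums)
    top⇒terminal {suc i , suc j} v∈V i+j≡n =
      subst (λ j′ → Terminal (suc i , j′)) (trans (cong (_∸ suc i) (sym i+j≡n)) (ℕ.m+n∸m≡n (suc i) (suc j)))
        (partialSum⇒Terminal (Gap⇒partialSum x i+j≡n (φ₁V⇒Gap x∈P v∈V)))

    φ₁-LocalΓFace : LocalΓFace n k (φ₁V x) (φ₁E x)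
    φ₁-LocalΓFace = record
      { tail∈V       = λ e∈E → _ , e∈E , inj₁ refl
      ; head∈V       = λ e∈E → _ , e∈E , inj₂ refl
      ; height≤n     = height≤n
      ; incoming     = incoming
      ; outgoing     = outgoing
      ; terminal∈V   = terminal∈φ₁V
      ; top⇒terminal = top⇒terminal
      }

module _ {c ℓ₁ ℓ₂} {K : OrderedField c ℓ₁ ℓ₂} {n : ℕ} {lam : ℕ → OrderedField.Carrier K}
         (F : GT.Face K n lam) where
  open OrderedField K using () renaming (refl to ≈-refl; _<_ to _<ᴷ_)
  open GT K n lam
  open PointGraph K n lam

  FacePoint : Set (c ⊔ ℓ₁ ⊔ ℓ₂)
  FacePoint = Σ Point (_∈F F)

  facePoint₀ : FacePoint
  facePoint₀ = Face.x₀ F , Face.x₀∈P F , ≈-refl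

  φ₁E⊆φE : ∀ {x} → x ∈F F → ∀ {e} → φ₁E x e → φE F e
  φ₁E⊆φE _ {_ , right} (inj₁ axis) = inj₁ axis
  φ₁E⊆φE _ {_ , down}  (inj₁ axis) = inj₁ axis
  φ₁E⊆φE {x} x∈F {(i , j) , right} (inj₂ (ij∈I , lt)) =
    inj₂ (ij∈I , x , x∈F , subst (xe x (suc i) (suc j) <ᴷ_) (xe-I x ij∈I) lt)
  φ₁E⊆φE {x} x∈F {(i , j) , down}  (inj₂ (ij∈I , lt)) =
    inj₂ (ij∈I , x , x∈F , subst (_<ᴷ xe x (suc i) (suc j)) (xe-I x ij∈I) lt)

  φE⊆⋃φ₁E : ∀ {e} → φE F e → ∃ λ (p : FacePoint) → φ₁E (proj₁ p) e
  φE⊆⋃φ₁E {_ , right} (inj₁ axis) = facePoint₀ , inj₁ axis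
  φE⊆⋃φ₁E {_ , down}  (inj₁ axis) = facePoint₀ , inj₁ axis
  φE⊆⋃φ₁E {(i , j) , right} (inj₂ (ij∈I , x , x∈F , lt)) =
    (x , x∈F) , inj₂ (ij∈I , subst (xe x (suc i) (suc j) <ᴷ_) (sym (xe-I x ij∈I)) lt)
  φE⊆⋃φ₁E {(i , j) , down}  (inj₂ (ij∈I , x , x∈F , lt)) =
    (x , x∈F) , inj₂ (ij∈I , subst (_<ᴷ xe x (suc i) (suc j)) (sym (xe-I x ij∈I)) lt)

  φ₁V⊆φV : ∀ {x} → x ∈F F → ∀ {v} → φ₁V x v → φV F v
  φ₁V⊆φV x∈F (e , e∈E , ends) = e , φ₁E⊆φE x∈F e∈E , ends

  φV⊆⋃φ₁V : ∀ {v} → φV F v → ∃ λ (p : FacePoint) → φ₁V (proj₁ p) v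
  φV⊆⋃φ₁V (e , e∈φE , ends) with φE⊆⋃φ₁E e∈φE
  ... | p , e∈E = p , e , e∈E , ends

corollary2p4 : ∀ {c ℓ₁ ℓ₂ : Level} (K : OrderedField c ℓ₁ ℓ₂)
    (n : ℕ) (k : List ℕ) (lam : ℕ → OrderedField.Carrier K) →
    1 < n → All (1 ≤_) k → sum k ≡ n → Adapted K n k lam →
    (F : GT.Face K n lam) →
    GammaGraph.IsΓFace n k (GT.φV K n lam F) (GT.φE K n lam F)
corollary2p4 K n k lam 1<n _ sum-k≡n adapted F =
  ⋃-IsΓFace n k (λ p → φ₁V (proj₁ p)) (λ p → φ₁E (proj₁ p)) (facePoint₀ F)
    (λ p → LocalΓFace⇒IsΓFace n k
             (φ₁-LocalΓFace (ℕ.<⇒≤ 1<n) sum-k≡n adapted (proj₁ (proj₂ p))))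
    (λ {p} → φ₁V⊆φV F (proj₂ p)) (λ {p} → φ₁E⊆φE F (proj₂ p))
    (φV⊆⋃φ₁V F) (φE⊆⋃φ₁E F)
  where
  open PointGraph K n lam
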